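{- Let $\mathbb{K}$ be a commutative ring with $1$, $x\in\mathbb{K}$, $0\le r\le k$, and let $\chi_k^{(r)}$ be the character (trace function) of the $\mathsf{M}_k(x)$-module $\mathsf{C}_k^{(r)}$. Then for $0\le\ell\le k$, $$\chi_k^{(r)}(\mathbf{1}_{\ell,k})=\begin{cases}\dim\mathsf{C}_\ell^{(r)}=\mathsf{m}_{\ell,r},& r\le\ell,\\ 0,& r>\ell.\end{cases}$$
   Context: A Motzkin $k$-diagram is a graph on top vertices $1,\dots,k$ and bottom vertices $1',\dots,k'$ with each vertex incident to at most one edge and edges non-crossing inside the rectangle. $\mathsf{M}_k(x)$ is the free $\mathbb{K}$-module on these diagrams with product $d_1d_2=x^\kappa d_3$ (stack $d_1$ over $d_2$, identify bottom vertex $j'$ of $d_1$ with top vertex $j$ of $d_2$; $d_3$ joins two outer vertices iff joined by a path; $\kappa$ = number of closed loops in the middle row). $\mathbf{1}_{\ell,k}$ has edges $j$–$j'$ for $j\le\ell$ and all other vertices isolated. A Motzkin path of length $k$ is $p=(a_1,\dots,a_k)\in\{ -1,0,1\}^k$ with nonnegative partial sums, rank $\sum a_i$; $\mathcal{P}_k^r$ is the set of paths of length $k$ and rank $r$ and $\mathsf{m}_{k,r}=|\mathcal{P}_k^r|$. 1-factor: for $a_i=1$ with $j>i$ minimal such that $a_i+\cdots+a_j=0$, positions $i,j$ are joined; unpaired positions with $a_i=1$ are white, others black. Action of a diagram $d$ on $p$: place $d$ above $p$ (bottom vertex $j'$ of $d$ identified with vertex $j$ of $p$); form the 1-factor $q$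 on the top row joining top vertices connected by a path and coloring a top vertex white iff its component contains a white vertex of $p$; $\kappa(d,p)$ = number of closed loops in the bottom row. $\mathsf{C}_k^{(r)}$ is the free $\mathbb{K}$-module with basis $\mathcal{P}_k^r$ and $d\cdot p=x^{\kappa(d,p)}q$ if $\mathrm{rank}(q)=r$ (number of white vertices of $q$), $0$ otherwise. -}

module Defs where

open import Level using (Level)
open import Data.Bool using (Bool; true; false; if_then_else_; _∧_)
open import Data.Nat using (ℕ; zero; suc; pred)
import Data.Nat as N
open import Data.Fin using (Fin; toℕ)
import Data.Fin as F
open import Data.List using (List; []; _∷_; filter; length; map; foldr; concatMap)
open import Data.Vec using (Vec; []; _∷_; lookup; allFin; zip; toList)
open import Data.Maybe using (Maybe; just; nothing)
open import Data.Product using (_×_; _,_; proj₁)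
open import Relation.Nullary.Decidable using (⌊_⌋)
open import Relation.Nullary using (yes; no; Dec)
open import Relation.Binary.PropositionalEquality using (_≡_; refl)
open import Algebra.Bundles using (CommutativeRing)

-- Motzkin paths: steps -1 (down), 0 (flat), +1 (up)

data Step : Set where
  down flat up : Step

_≟S_ : (a b : Step) → Dec (a ≡ b)
down ≟S down = yes refl
down ≟S flat = no λ ()
down ≟S up   = no λ ()
flat ≟S down = no λ ()
flat ≟S flat = yes refl
flat ≟S up   = no λ ()
up   ≟S down = no λ ()
up   ≟S flat = no λ ()
up   ≟S up   = yes refl

eqVec : ∀ {n} → Vec Step n → Vec Step n → Bool
eqVec [] [] = true
eqVec (a ∷ as) (b ∷ bs) = ⌊ a ≟S b ⌋ ∧ eqVec as bs

allSeqs : (k : ℕ) → List (Vec Step k)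
allSeqs zero = [] ∷ []
allSeqs (suc k) = concatMap (λ v → (down ∷ v) ∷ (flat ∷ v) ∷ (up ∷ v) ∷ []) (allSeqs k)

-- height walk starting at height h: nothing if some partial sum is negative,
-- otherwise just the final height (= h + rank)
heightWalk : ℕ → List Step → Maybe ℕ
heightWalk h [] = just h
heightWalk zero (down ∷ s) = nothing
heightWalk (suc h) (down ∷ s) = heightWalk h s
heightWalk h (flat ∷ s) = heightWalk h s
heightWalk h (up ∷ s) = heightWalk (suc h) s

isPathOfRank : ∀ {k} → ℕ → Vec Step k → Bool
isPathOfRank r p with heightWalk 0 (toList p)
... | nothing = false
... | just h = ⌊ h N.≟ r ⌋

Paths : (k r : ℕ) → List (Vec Step k)
Paths k r = filter (λ p → isPathOfRank r p Data.Bool.≟ true) (allSeqs k)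

m : ℕ → ℕ → ℕ
m k r = length (Paths k r)

indexed : ∀ {k} → Vec Step k → List (Fin k × Step)
indexed {k} p = toList (zip (allFin k) p)

-- scan with current excess c of up-steps; first position where it hits 0
fwd : ∀ {k} → ℕ → List (Fin k × Step) → Maybe (Fin k)
fwd c [] = nothing
fwd (suc zero) ((j , down) ∷ xs) = just j
fwd c ((j , down) ∷ xs) = fwd (pred c) xs
fwd c ((j , flat) ∷ xs) = fwd c xs
fwd c ((j , up) ∷ xs) = fwd (suc c) xs

-- for a_i = 1: the minimal j > i with a_i + ... + a_j = 0
fwdFrom : ∀ {k} → Vec Step k → Fin k → Maybe (Fin k)
fwdFrom p i = fwd 1 (filter (λ jt → i F.<? proj₁ jt) (indexed p))

firstJust : {A B : Set} → (A → Maybe B) → List A → Maybe B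
firstJust f [] = nothing
firstJust f (a ∷ as) with f a
... | just b = just b
... | nothing = firstJust f as

eqMaybeFin : ∀ {k} → Maybe (Fin k) → Fin k → Bool
eqMaybeFin nothing j = false
eqMaybeFin (just i) j = ⌊ i F.≟ j ⌋

-- partner of position i in the 1-factor of p (if any)
pmatch : ∀ {k} → Vec Step k → Fin k → Maybe (Fin k)
pmatch p i with lookup p i
... | up = fwdFrom p i
... | flat = nothing
... | down = firstJust
               (λ jt → if ⌊ proj₁ jt F.<? i ⌋ ∧ eqMaybeFin (fwdFrom p (proj₁ jt)) i
                        then just (proj₁ jt) else nothing)
               (filter (λ jt → proj₂' jt ≟S up) (indexed p))
  where proj₂' : ∀ {k} → Fin k × Step → Step
        proj₂' (_ , s) = s

isWhite : ∀ {k} → Vec Step k → Fin k → Bool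
isWhite p i with lookup p i | fwdFrom p i
... | up | nothing = true
... | _  | _ = false

-- Motzkin diagrams, given by their (partial) partner function on vertices

data Vtx (k : ℕ) : Set where
  top : Fin k → Vtx k
  bot : Fin k → Vtx k

Diagram : ℕ → Set
Diagram k = Vtx k → Maybe (Vtx k)

-- 𝟏_{ℓ,k}: edges j — j' for j ≤ ℓ (1-based), i.e. toℕ j < ℓ (0-based)
one : (ℓ k : ℕ) → Diagram k
one ℓ k (top j) = if ⌊ toℕ j N.<? ℓ ⌋ then just (bot j) else nothing
one ℓ k (bot j) = if ⌊ toℕ j N.<? ℓ ⌋ then just (top j) else nothing

data Fate (k : ℕ) : Set where
  toTop : Fin k → Fate k
  endW  : Fate k          -- ends in the top row alone, component contains a white vertex of p
  endB  : Fate k          -- ends in the top row alone, no white vertex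

-- walking from bottom vertex j (just entered via an edge of d)
walk : ∀ {k} → ℕ → Diagram k → Vec Step k → Fin k → Fate k
walk zero d p j = endB
walk (suc f) d p j with pmatch p j
... | nothing = if isWhite p j then endW else endB
... | just j2 with d (bot j2)
...   | nothing = endB
...   | just (top t) = toTop t
...   | just (bot j3) = walk f d p j3

fate : ∀ {k} → Diagram k → Vec Step k → Fin k → Fate k
fate {k} d p t with d (top t)
... | nothing = endB
... | just (top t') = toTop t'
... | just (bot j) = walk (suc k) d p j

-- the resulting colored 1-factor q on the top row, written as a step sequence
stepOf : ∀ {k} → Fin k → Fate k → Step
stepOf t (toTop t') = if ⌊ t F.<? t' ⌋ then up else down
stepOf t endW = up
stepOf t endB = flat

actPath : ∀ {k} → Diagram k → Vec Step k → Vec Step k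
actPath {k} d p = Data.Vec.map (λ t → stepOf t (fate d p t)) (allFin k)

isEndW : ∀ {k} → Fate k → Bool
isEndW endW = true
isEndW _ = false

-- rank(q) = number of white vertices of q
rankAct : ∀ {k} → Diagram k → Vec Step k → ℕ
rankAct {k} d p = length (filter (λ t → isEndW (fate d p t) Data.Bool.≟ true) (Data.List.allFin k))

-- closed loops in the bottom row: count each cycle at its minimal vertex s
cycleFrom : ∀ {k} → ℕ → Diagram k → Vec Step k → Fin k → Fin k → Bool
cycleFrom zero d p s c = false
cycleFrom (suc f) d p s c with d (bot c)
... | nothing = false
... | just (top _) = false
... | just (bot a) with pmatch p a
...   | nothing = false
...   | just b = if ⌊ s F.≤? a ⌋ ∧ ⌊ s F.≤? b ⌋
                   then (if ⌊ b F.≟ s ⌋ then true else cycleFrom f d p s b)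
                   else false

κ : ∀ {k} → Diagram k → Vec Step k → ℕ
κ {k} d p = length (filter (λ s → cycleFrom (suc k) d p s s Data.Bool.≟ true) (Data.List.allFin k))

module _ {c ℓ : Level} (R : CommutativeRing c ℓ) where
  open CommutativeRing R

  pow : Carrier → ℕ → Carrier
  pow y zero = 1#
  pow y (suc n) = y * pow y n

  natR : ℕ → Carrier
  natR zero = 0#
  natR (suc n) = 1# + natR n

  -- coefficient of basis path p' in d · p (in C_k^(r))
  coeff : ∀ {k} → Carrier → ℕ → Diagram k → Vec Step k → Vec Step k → Carrier
  coeff x r d p p' =
    if ⌊ rankAct d p N.≟ r ⌋ ∧ eqVec (actPath d p) p' then pow x (κ d p) else 0#

  χ : Carrier → (k r : ℕ) → Diagram k → Carrier
  χ x k r d = foldr _+_ 0# (map (λ p → coeff x r d p p) (Paths k r))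

-- 𝟏_{ℓ,k} joins top vertex j to bottom vertex j for j < ℓ and has no edge inside the bottom row, so it
-- closes no loop. If a path p is flat from position ℓ on, every matched pair of p lies below ℓ, so in
-- 𝟏_{ℓ,k} · p each top vertex j < ℓ is joined to the partner of j and each unpaired up step stays white:
-- the action fixes p. Otherwise a non-flat step at a position ≥ ℓ turns into an isolated black vertex,
-- so p contributes nothing to the trace. The trace therefore counts the rank-r Motzkin paths of length k
-- that are flat after position ℓ, i.e. the rank-r Motzkin paths of length ℓ, and there are none when ℓ < r.
-- Partners and white vertices are controlled by the reduced form downᵈ upᵘ of a word, obtained by
-- cancelling matched up–down pairs: a Motzkin path of rank r reduces to upʳ, and a down step of it is
-- preceded by a prefix with an unmatched up step.

module Submission where

open import Defs
open import Level using (Level)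
open import Algebra.Bundles using (CommutativeRing)
open import Data.Bool using (Bool; true; false; if_then_else_; _∧_)
import Data.Bool as B
open import Data.Bool.Properties using (∧-zeroʳ; ∧-identityʳ)
open import Data.Nat using (ℕ; zero; suc; z≤n; s≤s; _≤_; _<_; _+_)
open import Data.Nat.Tactic.RingSolver using (solve-∀)
import Data.Nat as N
open import Data.Nat.Properties
  using (+-suc; +-identityʳ; suc-injective; n≤1+n; m≤n⇒m≤1+n; ≤-trans; ≤-reflexive; <-trans; <-asym;
         +-mono-≤; +-monoʳ-≤; <⇒≱; ≰⇒>; ≮⇒≥; ≤⇒≯; m≤n⇒∃[o]m+o≡n)
open import Data.Fin as F using (Fin; toℕ)
open import Data.List as L using (List; []; _∷_; filter; length; map; foldr)
open import Data.Vec as V using (Vec; []; _∷_; lookup; zip; toList; tabulate)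
open import Data.Vec.Properties
  using (lookup-map; lookup-allFin; tabulate-allFin; tabulate-cong; tabulate∘lookup; toList-++)
open import Data.Maybe as M using (Maybe; just; nothing)
open import Data.Product using (_×_; _,_; proj₁; proj₂; ∃; map₁)
open import Relation.Nullary using (yes; no; Dec; ¬_; does; contradiction)
open import Relation.Nullary.Decidable using (⌊_⌋; isYes≗does; dec-true)
open import Relation.Binary.PropositionalEquality
  using (_≡_; refl; sym; trans; cong; cong₂; subst; module ≡-Reasoning)
open import Data.List.Membership.Propositional using (_∈_)
open import Data.List.Membership.Propositional.Properties using (∈-map⁺; ∈-map⁻; ∈-filter⁺; ∈-filter⁻)
open import Data.List.Relation.Unary.Any using (here; there)
open import Function using (_∘′_; case_of_)

boolToℕ : Bool → ℕ
boolToℕ true = 1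
boolToℕ false = 0

count : {A : Set} → (A → Bool) → List A → ℕ
count f [] = 0
count f (x ∷ xs) = boolToℕ (f x) + count f xs

length-filter-count : {A : Set} (f : A → Bool) (xs : List A) →
  length (filter (λ x → f x B.≟ true) xs) ≡ count f xs
length-filter-count f [] = refl
length-filter-count f (x ∷ xs) with f x
... | true = cong suc (length-filter-count f xs)
... | false = length-filter-count f xs

count-cong : {A : Set} {f g : A → Bool} (xs : List A) → (∀ x → f x ≡ g x) → count f xs ≡ count g xs
count-cong [] e = refl
count-cong (x ∷ xs) e = cong₂ _+_ (cong boolToℕ (e x)) (count-cong xs e)

count-false : {A : Set} {f : A → Bool} (xs : List A) → (∀ x → f x ≡ false) → count f xs ≡ 0
count-false [] e = refl
count-false (x ∷ xs) e rewrite e x = count-false xs e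

countFin : (n : ℕ) → (Fin n → Bool) → ℕ
countFin zero f = 0
countFin (suc n) f = boolToℕ (f F.zero) + countFin n (f ∘′ F.suc)

countFin-cong : ∀ n {f g : Fin n → Bool} → (∀ i → f i ≡ g i) → countFin n f ≡ countFin n g
countFin-cong zero e = refl
countFin-cong (suc n) e = cong₂ _+_ (cong boolToℕ (e F.zero)) (countFin-cong n (λ i → e (F.suc i)))

count-tabulate : ∀ {A : Set} n (f : A → Bool) (g : Fin n → A) → count f (L.tabulate g) ≡ countFin n (f ∘′ g)
count-tabulate zero f g = refl
count-tabulate (suc n) f g = cong (boolToℕ (f (g F.zero)) +_) (count-tabulate n f (g ∘′ F.suc))

zip-tabulate-suc : ∀ {n k} (f : Fin n → Fin k) (p : Vec Step n) →
  toList (zip (tabulate (F.suc ∘′ f)) p) ≡ map (map₁ F.suc) (toList (zip (tabulate f) p))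
zip-tabulate-suc f [] = refl
zip-tabulate-suc f (a ∷ p) = cong ((F.suc (f F.zero) , a) ∷_) (zip-tabulate-suc (f ∘′ F.suc) p)

indexed-∷ : ∀ {k} (a : Step) (p : Vec Step k) →
  indexed (a ∷ p) ≡ (F.zero , a) ∷ map (map₁ F.suc) (indexed p)
indexed-∷ a p = cong ((F.zero , a) ∷_) (zip-tabulate-suc (λ i → i) p)

∈-indexed⁺ : ∀ {k} (p : Vec Step k) j → (j , lookup p j) ∈ indexed p
∈-indexed⁺ (a ∷ p) F.zero = here refl
∈-indexed⁺ (a ∷ p) (F.suc j) =
  subst ((F.suc j , lookup p j) ∈_) (sym (indexed-∷ a p)) (there (∈-map⁺ (map₁ F.suc) (∈-indexed⁺ p j)))

∈-indexed⁻ : ∀ {k} (p : Vec Step k) {j s} → (j , s) ∈ indexed p → lookup p j ≡ s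
∈-indexed⁻ (a ∷ p) (here refl) = refl
∈-indexed⁻ (a ∷ p) (there mem)
  with ∈-map⁻ (map₁ F.suc) (subst (_ ∈_) (zip-tabulate-suc (λ i → i) p) mem)
... | (j , s) , mem′ , refl = ∈-indexed⁻ p mem′

filter-after-zero : ∀ {k} (a : Step) (xs : List (Fin k × Step)) →
  filter (λ jt → F.zero {k} F.<? proj₁ jt) ((F.zero , a) ∷ map (map₁ F.suc) xs) ≡ map (map₁ F.suc) xs
filter-after-zero a [] = refl
filter-after-zero a (x ∷ xs) = cong (map₁ F.suc x ∷_) (filter-after-zero a xs)

filter-after-suc : ∀ {k} (i : Fin k) (a : Step) (xs : List (Fin k × Step)) →
  filter (λ jt → F.suc i F.<? proj₁ jt) ((F.zero , a) ∷ map (map₁ F.suc) xs)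
    ≡ map (map₁ F.suc) (filter (λ jt → i F.<? proj₁ jt) xs)
filter-after-suc i a [] = refl
filter-after-suc i a ((j , s) ∷ xs) with does (i F.<? j)
... | true  = cong ((F.suc j , s) ∷_) (filter-after-suc i a xs)
... | false = filter-after-suc i a xs

fwd-map-suc : ∀ {k} c (xs : List (Fin k × Step)) →
  fwd c (map (map₁ F.suc) xs) ≡ M.map F.suc (fwd c xs)
fwd-map-suc c [] = refl
fwd-map-suc zero ((j , down) ∷ xs) = fwd-map-suc zero xs
fwd-map-suc (suc zero) ((j , down) ∷ xs) = refl
fwd-map-suc (suc (suc c)) ((j , down) ∷ xs) = fwd-map-suc (suc c) xs
fwd-map-suc zero ((j , flat) ∷ xs) = fwd-map-suc zero xs
fwd-map-suc (suc zero) ((j , flat) ∷ xs) = fwd-map-suc 1 xs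
fwd-map-suc (suc (suc c)) ((j , flat) ∷ xs) = fwd-map-suc (suc (suc c)) xs
fwd-map-suc zero ((j , up) ∷ xs) = fwd-map-suc 1 xs
fwd-map-suc (suc zero) ((j , up) ∷ xs) = fwd-map-suc 2 xs
fwd-map-suc (suc (suc c)) ((j , up) ∷ xs) = fwd-map-suc (suc (suc (suc c))) xs

-- fwd only computes once its counter is split into 0, 1 and ≥ 2.
fwd-flat : ∀ {k} c (j : Fin k) xs → fwd c ((j , flat) ∷ xs) ≡ fwd c xs
fwd-flat zero j xs = refl
fwd-flat (suc zero) j xs = refl
fwd-flat (suc (suc c)) j xs = refl

fwd-up : ∀ {k} c (j : Fin k) xs → fwd c ((j , up) ∷ xs) ≡ fwd (suc c) xs
fwd-up zero j xs = refl
fwd-up (suc zero) j xs = refl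
fwd-up (suc (suc c)) j xs = refl

fwd-∈ : ∀ {k} c (xs : List (Fin k × Step)) {t} → fwd c xs ≡ just t → (t , down) ∈ xs
fwd-∈ zero ((j , down) ∷ xs) e = there (fwd-∈ zero xs e)
fwd-∈ (suc zero) ((j , down) ∷ xs) refl = here refl
fwd-∈ (suc (suc c)) ((j , down) ∷ xs) e = there (fwd-∈ (suc c) xs e)
fwd-∈ c ((j , flat) ∷ xs) e = there (fwd-∈ c xs (trans (sym (fwd-flat c j xs)) e))
fwd-∈ c ((j , up) ∷ xs) e = there (fwd-∈ (suc c) xs (trans (sym (fwd-up c j xs)) e))

fwdFrom-zero : ∀ {k} a (p : Vec Step k) →
  fwdFrom (a ∷ p) F.zero ≡ M.map F.suc (fwd 1 (indexed p))
fwdFrom-zero {k} a p = begin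
  fwd 1 (filter (λ jt → F.zero {k} F.<? proj₁ jt) (indexed (a ∷ p)))
    ≡⟨ cong (λ xs → fwd 1 (filter (λ jt → F.zero {k} F.<? proj₁ jt) xs)) (indexed-∷ a p) ⟩
  fwd 1 (filter (λ jt → F.zero {k} F.<? proj₁ jt) ((F.zero , a) ∷ map (map₁ F.suc) (indexed p)))
    ≡⟨ cong (fwd 1) (filter-after-zero a (indexed p)) ⟩
  fwd 1 (map (map₁ F.suc) (indexed p))
    ≡⟨ fwd-map-suc 1 (indexed p) ⟩
  M.map F.suc (fwd 1 (indexed p)) ∎
  where open ≡-Reasoning

fwdFrom-suc : ∀ {k} a (p : Vec Step k) i →
  fwdFrom (a ∷ p) (F.suc i) ≡ M.map F.suc (fwdFrom p i)
fwdFrom-suc a p i = begin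
  fwd 1 (filter (λ jt → F.suc i F.<? proj₁ jt) (indexed (a ∷ p)))
    ≡⟨ cong (λ xs → fwd 1 (filter (λ jt → F.suc i F.<? proj₁ jt) xs)) (indexed-∷ a p) ⟩
  fwd 1 (filter (λ jt → F.suc i F.<? proj₁ jt) ((F.zero , a) ∷ map (map₁ F.suc) (indexed p)))
    ≡⟨ cong (fwd 1) (filter-after-suc i a (indexed p)) ⟩
  fwd 1 (map (map₁ F.suc) (filter (λ jt → i F.<? proj₁ jt) (indexed p)))
    ≡⟨ fwd-map-suc 1 (filter (λ jt → i F.<? proj₁ jt) (indexed p)) ⟩
  M.map F.suc (fwdFrom p i) ∎
  where open ≡-Reasoning

fwdFrom-closes : ∀ {k} (p : Vec Step k) j {t} → fwdFrom p j ≡ just t → j F.< t × lookup p t ≡ down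
fwdFrom-closes p j e with ∈-filter⁻ (λ jt → j F.<? proj₁ jt) (fwd-∈ 1 _ e)
... | mem , j<t = j<t , ∈-indexed⁻ p mem

-- Reduced words

push : Step → ℕ × ℕ → ℕ × ℕ
push down (d , u) = suc d , u
push flat q = q
push up (zero , u) = zero , suc u
push up (suc d , u) = d , u

-- Cancelling matched up–down pairs leaves a word downᵈ upᵘ; reduce p = (d , u).
reduce : ∀ {k} → Vec Step k → ℕ × ℕ
reduce [] = 0 , 0
reduce (a ∷ p) = push a (reduce p)

reducePrefix : ∀ {k} → Vec Step k → Fin k → ℕ × ℕ
reducePrefix (a ∷ p) F.zero = 0 , 0
reducePrefix (a ∷ p) (F.suc t) = push a (reducePrefix p t)

-- downᵈ upᵘ can be walked from height h to height x
Walkable : ℕ → ℕ → ℕ × ℕ → Set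
Walkable h x (d , u) = d ≤ h × x + d ≡ h + u

-- downᵈ upᵘ, started at height h, ends strictly above ground
EndsPositive : ℕ → ℕ × ℕ → Set
EndsPositive h (d , u) = d < h + u

walkable-push-up : ∀ h x q → Walkable (suc h) x q → Walkable h x (push up q)
walkable-push-up h x (zero , u) (_ , e) = z≤n , trans e (sym (+-suc h u))
walkable-push-up h x (suc d , u) (s≤s le , e) = le , suc-injective (trans (sym (+-suc x d)) e)

endsPositive-push-up : ∀ h q → EndsPositive (suc h) q → EndsPositive h (push up q)
endsPositive-push-up h (zero , u) _ = ≤-trans (s≤s z≤n) (≤-reflexive (sym (+-suc h u)))
endsPositive-push-up h (suc d , u) (s≤s lt) = lt

heightWalk⇒walkable : ∀ {k} (p : Vec Step k) h x →
  heightWalk h (toList p) ≡ just x → Walkable h x (reduce p)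
heightWalk⇒walkable [] h .h refl = z≤n , refl
heightWalk⇒walkable (down ∷ p) zero x ()
heightWalk⇒walkable (down ∷ p) (suc h) x eq with heightWalk⇒walkable p h x eq
... | le , e = s≤s le , trans (+-suc x _) (cong suc e)
heightWalk⇒walkable (flat ∷ p) zero x eq = heightWalk⇒walkable p zero x eq
heightWalk⇒walkable (flat ∷ p) (suc h) x eq = heightWalk⇒walkable p (suc h) x eq
heightWalk⇒walkable (up ∷ p) zero x eq =
  walkable-push-up zero x (reduce p) (heightWalk⇒walkable p 1 x eq)
heightWalk⇒walkable (up ∷ p) (suc h) x eq =
  walkable-push-up (suc h) x (reduce p) (heightWalk⇒walkable p (suc (suc h)) x eq)

path⇒reduce : ∀ {k} (p : Vec Step k) r → heightWalk 0 (toList p) ≡ just r → reduce p ≡ (0 , r)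
path⇒reduce p r hw with reduce p | heightWalk⇒walkable p 0 r hw
... | zero , u | _ , e = cong (0 ,_) (sym (trans (sym (+-identityʳ r)) e))

endsPositive-before-down : ∀ {k} (p : Vec Step k) t h x →
  heightWalk h (toList p) ≡ just x → lookup p t ≡ down → EndsPositive h (reducePrefix p t)
endsPositive-before-down (down ∷ p) F.zero zero x () _
endsPositive-before-down (down ∷ p) F.zero (suc h) x _ _ = s≤s z≤n
endsPositive-before-down (down ∷ p) (F.suc t) zero x () _
endsPositive-before-down (down ∷ p) (F.suc t) (suc h) x eq isDown =
  s≤s (endsPositive-before-down p t h x eq isDown)
endsPositive-before-down (flat ∷ p) (F.suc t) zero x eq isDown =
  endsPositive-before-down p t zero x eq isDown
endsPositive-before-down (flat ∷ p) (F.suc t) (suc h) x eq isDown =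
  endsPositive-before-down p t (suc h) x eq isDown
endsPositive-before-down (up ∷ p) (F.suc t) zero x eq isDown =
  endsPositive-push-up zero _ (endsPositive-before-down p t 1 x eq isDown)
endsPositive-before-down (up ∷ p) (F.suc t) (suc h) x eq isDown =
  endsPositive-push-up (suc h) _ (endsPositive-before-down p t (suc (suc h)) x eq isDown)

fwd-reaches-down : ∀ {k} (p : Vec Step k) t c →
  lookup p t ≡ down → reducePrefix p t ≡ (c , 0) → fwd (suc c) (indexed p) ≡ just t
fwd-reaches-down (down ∷ p) F.zero .0 refl refl = cong (fwd 1) (indexed-∷ down p)
fwd-reaches-down (a ∷ p) (F.suc t) c isDown eq =
  trans (cong (fwd (suc c)) (indexed-∷ a p)) (go a (reducePrefix p t) refl eq)
  where
  xs = map (map₁ F.suc) (indexed p)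
  ih : ∀ d → reducePrefix p t ≡ (d , 0) → fwd (suc d) xs ≡ just (F.suc t)
  ih d e = trans (fwd-map-suc (suc d) (indexed p)) (cong (M.map F.suc) (fwd-reaches-down p t d isDown e))
  go : ∀ b q → reducePrefix p t ≡ q → push b q ≡ (c , 0) → fwd (suc c) ((F.zero , b) ∷ xs) ≡ just (F.suc t)
  go down (d , .0) e refl = ih d e
  go flat (d , .0) e refl = trans (fwd-flat (suc d) F.zero xs) (ih d e)
  go up (suc d , .0) e refl = trans (fwd-up (suc d) F.zero xs) (ih (suc d) e)

down-has-opener : ∀ {k} (p : Vec Step k) t → lookup p t ≡ down → 1 ≤ proj₂ (reducePrefix p t) →
  ∃ λ j → lookup p j ≡ up × fwdFrom p j ≡ just t
down-has-opener (a ∷ p) (F.suc t) isDown open≥1 = go a refl (reducePrefix p t) refl open≥1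
  where
  later : ∀ q → reducePrefix p t ≡ q → 1 ≤ proj₂ q →
          ∃ λ j → lookup (a ∷ p) j ≡ up × fwdFrom (a ∷ p) j ≡ just (F.suc t)
  later q refl ge with down-has-opener p t isDown ge
  ... | j , isUp , e = F.suc j , isUp , trans (fwdFrom-suc a p j) (cong (M.map F.suc) e)
  go : ∀ b → a ≡ b → ∀ q → reducePrefix p t ≡ q → 1 ≤ proj₂ (push b q) →
       ∃ λ j → lookup (a ∷ p) j ≡ up × fwdFrom (a ∷ p) j ≡ just (F.suc t)
  go down _ q e ge = later q e ge
  go flat _ q e ge = later q e ge
  go up _ (suc d , u) e ge = later _ e ge
  go up _ (zero , suc u) e _ = later _ e (s≤s z≤n)
  go up refl (zero , zero) e _ =
    F.zero , refl , trans (fwdFrom-zero up p) (cong (M.map F.suc) (fwd-reaches-down p t 0 isDown e))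

fwd-nothing : ∀ {k} (p : Vec Step k) c → proj₁ (reduce p) ≤ c → fwd (suc c) (indexed p) ≡ nothing
fwd-nothing [] c _ = refl
fwd-nothing (a ∷ p) c le = trans (cong (fwd (suc c)) (indexed-∷ a p)) (go a c (reduce p) refl le)
  where
  xs = map (map₁ F.suc) (indexed p)
  ih : ∀ {c q} → reduce p ≡ q → proj₁ q ≤ c → fwd (suc c) xs ≡ nothing
  ih {c} refl le = trans (fwd-map-suc (suc c) (indexed p)) (cong (M.map F.suc) (fwd-nothing p c le))
  go : ∀ b c q → reduce p ≡ q → proj₁ (push b q) ≤ c → fwd (suc c) ((F.zero , b) ∷ xs) ≡ nothing
  go down (suc c) q e (s≤s le) = ih e le
  go flat c q e le = trans (fwd-flat (suc c) F.zero xs) (ih e le)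
  go up c (zero , u) e _ = trans (fwd-up (suc c) F.zero xs) (ih e z≤n)
  go up c (suc d , u) e le = trans (fwd-up (suc c) F.zero xs) (ih e (s≤s le))

fwd-just : ∀ {k} (p : Vec Step k) c → c < proj₁ (reduce p) → ∃ λ t → fwd (suc c) (indexed p) ≡ just t
fwd-just (a ∷ p) c lt =
  subst (λ ys → ∃ λ t → fwd (suc c) ys ≡ just t) (sym (indexed-∷ a p)) (go a c (reduce p) refl lt)
  where
  xs = map (map₁ F.suc) (indexed p)
  ih : ∀ {c q} → reduce p ≡ q → c < proj₁ q → ∃ λ t → fwd (suc c) xs ≡ just t
  ih {c} refl lt with fwd-just p c lt
  ... | t , e = F.suc t , trans (fwd-map-suc (suc c) (indexed p)) (cong (M.map F.suc) e)
  go : ∀ b c q → reduce p ≡ q → c < proj₁ (push b q) → ∃ λ t → fwd (suc c) ((F.zero , b) ∷ xs) ≡ just t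
  go down zero q e _ = F.zero , refl
  go down (suc c) q e (s≤s lt) = ih e lt
  go flat c q e lt = let t , e′ = ih e lt in t , trans (fwd-flat (suc c) F.zero xs) e′
  go up c (suc d , u) e lt = let t , e′ = ih e (s≤s lt) in t , trans (fwd-up (suc c) F.zero xs) e′

white : ∀ {k} → Step → Maybe (Fin k) → Bool
white up nothing = true
white up (just _) = false
white flat _ = false
white down _ = false

isWhite-white : ∀ {k} (p : Vec Step k) i → isWhite p i ≡ white (lookup p i) (fwdFrom p i)
isWhite-white p i with lookup p i | fwdFrom p i
... | up | nothing = refl
... | up | just _ = refl
... | flat | _ = refl
... | down | _ = refl

isWhite-at : ∀ {k} (p : Vec Step k) t {s} → lookup p t ≡ s → isWhite p t ≡ white s (fwdFrom p t)
isWhite-at p t e = trans (isWhite-white p t) (cong (λ s → white s (fwdFrom p t)) e)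

white-map-suc : ∀ {k} s (o : Maybe (Fin k)) → white s (M.map F.suc o) ≡ white s o
white-map-suc up nothing = refl
white-map-suc up (just _) = refl
white-map-suc flat _ = refl
white-map-suc down _ = refl

isWhite-zero : ∀ {k} a (p : Vec Step k) → isWhite (a ∷ p) F.zero ≡ white a (fwd 1 (indexed p))
isWhite-zero a p =
  trans (isWhite-white (a ∷ p) F.zero) (trans (cong (white a) (fwdFrom-zero a p)) (white-map-suc a _))

isWhite-suc : ∀ {k} a (p : Vec Step k) i → isWhite (a ∷ p) (F.suc i) ≡ isWhite p i
isWhite-suc a p i = begin
  isWhite (a ∷ p) (F.suc i)                       ≡⟨ isWhite-white (a ∷ p) (F.suc i) ⟩
  white (lookup p i) (fwdFrom (a ∷ p) (F.suc i))  ≡⟨ cong (white (lookup p i)) (fwdFrom-suc a p i) ⟩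
  white (lookup p i) (M.map F.suc (fwdFrom p i))  ≡⟨ white-map-suc (lookup p i) (fwdFrom p i) ⟩
  white (lookup p i) (fwdFrom p i)                ≡⟨ isWhite-white p i ⟨
  isWhite p i                                     ∎
  where open ≡-Reasoning

-- A leading up step stays unmatched exactly when the rest has no unmatched down step.
push-counts-white : ∀ {k} a (p : Vec Step k) →
  boolToℕ (white a (fwd 1 (indexed p))) + proj₂ (reduce p) ≡ proj₂ (push a (reduce p))
push-counts-white down p = refl
push-counts-white flat p = refl
push-counts-white up p with reduce p in e
... | zero , u rewrite fwd-nothing p 0 (subst (λ q → proj₁ q ≤ 0) (sym e) z≤n) = refl
... | suc d , u with fwd-just p 0 (subst (λ q → 0 < proj₁ q) (sym e) (s≤s z≤n))
...   | t , e′ rewrite e′ = refl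

whiteCount-reduce : ∀ {k} (p : Vec Step k) → countFin k (isWhite p) ≡ proj₂ (reduce p)
whiteCount-reduce [] = refl
whiteCount-reduce {suc k} (a ∷ p) = begin
  boolToℕ (isWhite (a ∷ p) F.zero) + countFin k (isWhite (a ∷ p) ∘′ F.suc)
    ≡⟨ cong₂ _+_ (cong boolToℕ (isWhite-zero a p)) (countFin-cong k (isWhite-suc a p)) ⟩
  boolToℕ (white a (fwd 1 (indexed p))) + countFin k (isWhite p)
    ≡⟨ cong (boolToℕ (white a (fwd 1 (indexed p))) +_) (whiteCount-reduce p) ⟩
  boolToℕ (white a (fwd 1 (indexed p))) + proj₂ (reduce p)
    ≡⟨ push-counts-white a p ⟩
  proj₂ (push a (reduce p)) ∎
  where open ≡-Reasoning

firstJust-complete : {A B : Set} (f : A → Maybe B) {xs : List A} {a : A} {b : B} →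
  a ∈ xs → f a ≡ just b → ∃ λ b′ → firstJust f xs ≡ just b′
firstJust-complete f {x ∷ xs} mem fa with f x in fx
... | just b′ = b′ , refl
firstJust-complete f {x ∷ xs} (here refl) fa | nothing with () ← trans (sym fx) fa
firstJust-complete f {x ∷ xs} (there mem) fa | nothing = firstJust-complete f mem fa

firstJust-sound : {A B : Set} (f : A → Maybe B) (xs : List A) {b : B} →
  firstJust f xs ≡ just b → ∃ λ a → f a ≡ just b
firstJust-sound f (x ∷ xs) e with f x in fx
... | just b′ = x , trans fx e
... | nothing = firstJust-sound f xs e

-- the test pmatch applies to an up step jt when looking for the opener of the down step at t
openerOf : ∀ {k} → Vec Step k → Fin k → Fin k × Step → Maybe (Fin k)
openerOf p t jt = if ⌊ proj₁ jt F.<? t ⌋ ∧ eqMaybeFin (fwdFrom p (proj₁ jt)) t then just (proj₁ jt) else nothing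

openerOf-before : ∀ {k} (p : Vec Step k) t jt {j} → openerOf p t jt ≡ just j → j F.< t
openerOf-before p t (i , _) e with i F.<? t | fwdFrom p i
... | yes i<t | just t′ with t′ F.≟ t
...   | yes _ with refl ← e = i<t
openerOf-before p t (i , _) () | yes _ | just t′ | no _
openerOf-before p t (i , _) () | yes _ | nothing
openerOf-before p t (i , _) () | no _ | _

openerOf-accepts : ∀ {k} (p : Vec Step k) j t s → fwdFrom p j ≡ just t → openerOf p t (j , s) ≡ just j
openerOf-accepts p j t s e rewrite e with j F.<? t | t F.≟ t
... | yes _ | yes _ = refl
... | no j≮t | _ = contradiction (proj₁ (fwdFrom-closes p j e)) j≮t
... | yes _ | no t≢t = contradiction refl t≢t

pmatch-up : ∀ {k} (p : Vec Step k) t → lookup p t ≡ up → pmatch p t ≡ fwdFrom p t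
pmatch-up p t isUp rewrite isUp = refl

pmatch-flat : ∀ {k} (p : Vec Step k) t → lookup p t ≡ flat → pmatch p t ≡ nothing
pmatch-flat p t isFlat rewrite isFlat = refl

pmatch-down : ∀ {k} (p : Vec Step k) t j → lookup p t ≡ down → lookup p j ≡ up → fwdFrom p j ≡ just t →
  ∃ λ i → pmatch p t ≡ just i × i F.< t
pmatch-down p t j isDown isUp e rewrite isDown
  with firstJust-complete (openerOf p t) (∈-filter⁺ (λ jt → proj₂ jt ≟S up) (∈-indexed⁺ p j) isUp)
                             (openerOf-accepts p j t up e)
... | i , found with firstJust-sound (openerOf p t) (filter (λ jt → proj₂ jt ≟S up) (indexed p)) found
... | jt , accepted = i , found , openerOf-before p t jt accepted

path-down-matched : ∀ {k} (p : Vec Step k) r t → heightWalk 0 (toList p) ≡ just r → lookup p t ≡ down →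
  ∃ λ i → pmatch p t ≡ just i × i F.< t
path-down-matched p r t hw isDown
  with down-has-opener p t isDown (≤-trans (s≤s z≤n) (endsPositive-before-down p t 0 r hw isDown))
... | j , isUp , e = pmatch-down p t j isDown isUp e

-- The action of 𝟏_{ℓ,k}

FlatFrom : ∀ {k} → ℕ → Vec Step k → Set
FlatFrom l p = ∀ t → l ≤ toℕ t → lookup p t ≡ flat

flatFrom-bound : ∀ {k} l (p : Vec Step k) t → FlatFrom l p → lookup p t ≡ down → toℕ t < l
flatFrom-bound l p t flatFrom isDown = ≰⇒> λ l≤t → case trans (sym (flatFrom t l≤t)) isDown of λ ()

fate-outside : ∀ {k} l (p : Vec Step k) t → ¬ toℕ t < l → fate (one l k) p t ≡ endB
fate-outside l p t t≮l with toℕ t N.<? l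
... | yes t<l = contradiction t<l t≮l
... | no _ = refl

fate-inside : ∀ {k} l (p : Vec Step k) t → toℕ t < l → fate (one l k) p t ≡ walk (suc k) (one l k) p t
fate-inside l p t t<l with toℕ t N.<? l
... | yes _ = refl
... | no t≮l = contradiction t<l t≮l

walk-matched : ∀ {k} l f (p : Vec Step k) t j → pmatch p t ≡ just j → toℕ j < l →
  walk (suc f) (one l k) p t ≡ toTop j
walk-matched l f p t j e j<l rewrite e with toℕ j N.<? l
... | yes _ = refl
... | no j≮l = contradiction j<l j≮l

walk-unmatched : ∀ {k} l f (p : Vec Step k) t → pmatch p t ≡ nothing →
  walk (suc f) (one l k) p t ≡ (if isWhite p t then endW else endB)
walk-unmatched l f p t e rewrite e = refl

stepOf-opens : ∀ {k} {t j : Fin k} → t F.< j → stepOf t (toTop j) ≡ up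
stepOf-opens {t = t} {j} t<j with t F.<? j
... | yes _ = refl
... | no t≮j = contradiction t<j t≮j

stepOf-closes : ∀ {k} {t j : Fin k} → j F.< t → stepOf t (toTop j) ≡ down
stepOf-closes {t = t} {j} j<t with t F.<? j
... | yes t<j = contradiction t<j (<-asym j<t)
... | no _ = refl

-- top vertex t of d · p carries the same step and colour as position t of p
Restores : ∀ {k} → Diagram k → Vec Step k → Fin k → Set
Restores d p t = stepOf t (fate d p t) ≡ lookup p t × isEndW (fate d p t) ≡ isWhite p t

restores-via : ∀ {k} (d : Diagram k) p t {φ} →
  fate d p t ≡ φ → stepOf t φ ≡ lookup p t → isEndW φ ≡ isWhite p t → Restores d p t
restores-via d p t e s w rewrite e = s , w

one-restores : ∀ {k} l r (p : Vec Step k) → heightWalk 0 (toList p) ≡ just r → FlatFrom l p →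
  ∀ t → Restores (one l k) p t
one-restores {k} l r p hw flatFrom t = by (toℕ t N.<? l)
  where
  by : Dec (toℕ t < l) → Restores (one l k) p t
  by (no t≮l) = restores-via (one l k) p t (fate-outside l p t t≮l) (sym isFlat) (sym (isWhite-at p t isFlat))
    where isFlat = flatFrom t (≮⇒≥ t≮l)
  by (yes t<l) = inside (lookup p t) refl
    where
    walks : ∀ {φ} → walk (suc k) (one l k) p t ≡ φ → fate (one l k) p t ≡ φ
    walks = trans (fate-inside l p t t<l)
    unmatched : pmatch p t ≡ nothing → ∀ {b} → isWhite p t ≡ b → fate (one l k) p t ≡ (if b then endW else endB)
    unmatched e w = walks (trans (walk-unmatched l k p t e) (cong (λ b → if b then endW else endB) w))
    up-case : lookup p t ≡ up → ∀ o → fwdFrom p t ≡ o → Restores (one l k) p t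
    up-case isUp (just j) e = restores-via (one l k) p t
        (walks (walk-matched l k p t j (trans (pmatch-up p t isUp) e) (flatFrom-bound l p j flatFrom isDown)))
        (trans (stepOf-opens t<j) (sym isUp)) (sym (trans (isWhite-at p t isUp) (cong (white up) e)))
      where t<j = proj₁ (fwdFrom-closes p t e)
            isDown = proj₂ (fwdFrom-closes p t e)
    up-case isUp nothing e = restores-via (one l k) p t (unmatched (trans (pmatch-up p t isUp) e) w) (sym isUp) (sym w)
      where w = trans (isWhite-at p t isUp) (cong (white up) e)
    inside : ∀ s → lookup p t ≡ s → Restores (one l k) p t
    inside up isUp = up-case isUp (fwdFrom p t) refl
    inside flat isFlat = restores-via (one l k) p t (unmatched (pmatch-flat p t isFlat) w) (sym isFlat) (sym w)
      where w = isWhite-at p t isFlat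
    inside down isDown with i , e , i<t ← path-down-matched p r t hw isDown =
      restores-via (one l k) p t (walks (walk-matched l k p t i e (<-trans i<t t<l)))
        (trans (stepOf-closes i<t) (sym isDown)) (sym (isWhite-at p t isDown))

lookup-actPath : ∀ {k} (d : Diagram k) (p : Vec Step k) t → lookup (actPath d p) t ≡ stepOf t (fate d p t)
lookup-actPath {k} d p t =
  trans (lookup-map t (λ t → stepOf t (fate d p t)) (V.allFin k)) (cong (λ i → stepOf i (fate d p i)) (lookup-allFin t))

actPath-one-fixes : ∀ {k} l r (p : Vec Step k) → heightWalk 0 (toList p) ≡ just r → FlatFrom l p →
  actPath (one l k) p ≡ p
actPath-one-fixes {k} l r p hw flatFrom = begin
  V.map (λ t → stepOf t (fate (one l k) p t)) (V.allFin k)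
    ≡⟨ tabulate-allFin _ ⟨
  tabulate (λ t → stepOf t (fate (one l k) p t))
    ≡⟨ tabulate-cong (λ t → proj₁ (one-restores l r p hw flatFrom t)) ⟩
  tabulate (lookup p)
    ≡⟨ tabulate∘lookup p ⟩
  p ∎
  where open ≡-Reasoning

actPath-one-fixes⇒flatFrom : ∀ {k} l (p : Vec Step k) → actPath (one l k) p ≡ p → FlatFrom l p
actPath-one-fixes⇒flatFrom {k} l p fixes t l≤t = begin
  lookup p t                           ≡⟨ cong (λ v → lookup v t) fixes ⟨
  lookup (actPath (one l k) p) t       ≡⟨ lookup-actPath (one l k) p t ⟩
  stepOf t (fate (one l k) p t)        ≡⟨ cong (stepOf t) (fate-outside l p t (≤⇒≯ l≤t)) ⟩
  flat                                 ∎
  where open ≡-Reasoning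

rankAct-one : ∀ {k} l r (p : Vec Step k) → heightWalk 0 (toList p) ≡ just r → FlatFrom l p →
  rankAct (one l k) p ≡ r
rankAct-one {k} l r p hw flatFrom = begin
  length (filter (λ t → isEndW (fate (one l k) p t) B.≟ true) (L.allFin k))
    ≡⟨ length-filter-count _ (L.allFin k) ⟩
  count (λ t → isEndW (fate (one l k) p t)) (L.allFin k)
    ≡⟨ count-tabulate k _ (λ t → t) ⟩
  countFin k (λ t → isEndW (fate (one l k) p t))
    ≡⟨ countFin-cong k (λ t → proj₂ (one-restores l r p hw flatFrom t)) ⟩
  countFin k (isWhite p)
    ≡⟨ whiteCount-reduce p ⟩
  proj₂ (reduce p)
    ≡⟨ cong proj₂ (path⇒reduce p r hw) ⟩
  r ∎
  where open ≡-Reasoning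

cycleFrom-one : ∀ {k} l f (p : Vec Step k) s c → cycleFrom (suc f) (one l k) p s c ≡ false
cycleFrom-one l f p s c with toℕ c N.<? l
... | yes _ = refl
... | no _ = refl

κ-one : ∀ {k} l (p : Vec Step k) → κ (one l k) p ≡ 0
κ-one {k} l p = trans (length-filter-count _ (L.allFin k)) (count-false (L.allFin k) (λ s → cycleFrom-one l k p s s))

eqVec-refl : ∀ {n} (u : Vec Step n) → eqVec u u ≡ true
eqVec-refl [] = refl
eqVec-refl (down ∷ u) = eqVec-refl u
eqVec-refl (flat ∷ u) = eqVec-refl u
eqVec-refl (up ∷ u) = eqVec-refl u

eqVec-sound : ∀ {n} (u v : Vec Step n) → eqVec u v ≡ true → u ≡ v
eqVec-sound [] [] _ = refl
eqVec-sound (a ∷ u) (b ∷ v) e with a ≟S b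
... | yes refl = cong (a ∷_) (eqVec-sound u v e)

-- Counting Motzkin paths

isFlat : Step → Bool
isFlat flat = true
isFlat down = false
isFlat up = false

allFlat : ∀ {k} → Vec Step k → Bool
allFlat [] = true
allFlat (a ∷ v) = isFlat a ∧ allFlat v

flatFromᵇ : ∀ {k} → ℕ → Vec Step k → Bool
flatFromᵇ zero v = allFlat v
flatFromᵇ (suc n) [] = true
flatFromᵇ (suc n) (a ∷ v) = flatFromᵇ n v

flatFromᵇ-sound : ∀ {k} l (p : Vec Step k) → flatFromᵇ l p ≡ true → FlatFrom l p
flatFromᵇ-sound zero (flat ∷ p) e F.zero _ = refl
flatFromᵇ-sound zero (flat ∷ p) e (F.suc t) _ = flatFromᵇ-sound zero p e t z≤n
flatFromᵇ-sound (suc l) (a ∷ p) e (F.suc t) (s≤s l≤t) = flatFromᵇ-sound l p e t l≤t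

flatFromᵇ-complete : ∀ {k} l (p : Vec Step k) → FlatFrom l p → flatFromᵇ l p ≡ true
flatFromᵇ-complete zero [] _ = refl
flatFromᵇ-complete zero (a ∷ p) flatFrom with flatFrom F.zero z≤n
... | refl = flatFromᵇ-complete zero p (λ t _ → flatFrom (F.suc t) z≤n)
flatFromᵇ-complete (suc l) [] _ = refl
flatFromᵇ-complete (suc l) (a ∷ p) flatFrom = flatFromᵇ-complete l p (λ t l≤t → flatFrom (F.suc t) (s≤s l≤t))

isPathOfRank-sound : ∀ {k} r (p : Vec Step k) → isPathOfRank r p ≡ true → heightWalk 0 (toList p) ≡ just r
isPathOfRank-sound r p e with heightWalk 0 (toList p)
... | just h with h N.≟ r
...   | yes refl = refl

isPathOfRank-cong : ∀ {k n} r (p : Vec Step k) (q : Vec Step n) →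
  heightWalk 0 (toList p) ≡ heightWalk 0 (toList q) → isPathOfRank r p ≡ isPathOfRank r q
isPathOfRank-cong r p q e rewrite e = refl

heightWalk-bound : ∀ {k} (p : Vec Step k) h {x} → heightWalk h (toList p) ≡ just x → x ≤ h + k
heightWalk-bound [] h refl = ≤-reflexive (sym (+-identityʳ h))
heightWalk-bound (down ∷ p) (suc h) e = ≤-trans (heightWalk-bound p h e) (+-mono-≤ (n≤1+n h) (n≤1+n _))
heightWalk-bound (flat ∷ p) zero e = m≤n⇒m≤1+n (heightWalk-bound p zero e)
heightWalk-bound (flat ∷ p) (suc h) e = ≤-trans (heightWalk-bound p (suc h) e) (+-monoʳ-≤ (suc h) (n≤1+n _))
heightWalk-bound (up ∷ p) zero e = heightWalk-bound p 1 e
heightWalk-bound {suc k} (up ∷ p) (suc h) e =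
  ≤-trans (heightWalk-bound p (suc (suc h)) e) (≤-reflexive (sym (+-suc (suc h) k)))

isPathOfRank-short : ∀ {k} r (p : Vec Step k) → k < r → isPathOfRank r p ≡ false
isPathOfRank-short {k} r p k<r with isPathOfRank r p in e
... | false = refl
... | true = contradiction (heightWalk-bound p 0 (isPathOfRank-sound r p e)) (<⇒≱ k<r)

heightWalk-flats : ∀ h e → heightWalk h (toList (V.replicate e flat)) ≡ just h
heightWalk-flats h zero = refl
heightWalk-flats zero (suc e) = heightWalk-flats zero e
heightWalk-flats (suc h) (suc e) = heightWalk-flats (suc h) e

heightWalk-++-flats : ∀ h (xs : List Step) e → heightWalk h (xs L.++ toList (V.replicate e flat)) ≡ heightWalk h xs
heightWalk-++-flats h [] e = heightWalk-flats h e
heightWalk-++-flats zero (down ∷ xs) e = refl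
heightWalk-++-flats (suc h) (down ∷ xs) e = heightWalk-++-flats h xs e
heightWalk-++-flats zero (flat ∷ xs) e = heightWalk-++-flats zero xs e
heightWalk-++-flats (suc h) (flat ∷ xs) e = heightWalk-++-flats (suc h) xs e
heightWalk-++-flats zero (up ∷ xs) e = heightWalk-++-flats 1 xs e
heightWalk-++-flats (suc h) (up ∷ xs) e = heightWalk-++-flats (suc (suc h)) xs e

isPathOfRank-++-flats : ∀ {n} r e (u : Vec Step n) → isPathOfRank r (u V.++ V.replicate e flat) ≡ isPathOfRank r u
isPathOfRank-++-flats r e u = isPathOfRank-cong r (u V.++ V.replicate e flat) u
  (trans (cong (heightWalk 0) (toList-++ u (V.replicate e flat))) (heightWalk-++-flats 0 (toList u) e))

+-interchange₃ : ∀ a b c x y z → a + (b + (c + (x + y + z))) ≡ (a + x) + (b + y) + (c + z)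
+-interchange₃ = solve-∀

count-allSeqs-suc : ∀ k (f : Vec Step (suc k) → Bool) →
  count f (allSeqs (suc k))
    ≡ count (f ∘′ (down ∷_)) (allSeqs k) + count (f ∘′ (flat ∷_)) (allSeqs k)
      + count (f ∘′ (up ∷_)) (allSeqs k)
count-allSeqs-suc k f = go (allSeqs k)
  where
  go : ∀ xs → count f (L.concatMap (λ v → (down ∷ v) ∷ (flat ∷ v) ∷ (up ∷ v) ∷ []) xs)
                ≡ count (f ∘′ (down ∷_)) xs + count (f ∘′ (flat ∷_)) xs + count (f ∘′ (up ∷_)) xs
  go [] = refl
  go (v ∷ xs) = trans (cong (λ n → d + (z + (u + n))) (go xs)) (+-interchange₃ d z u _ _ _)
    where d = boolToℕ (f (down ∷ v))
          z = boolToℕ (f (flat ∷ v))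
          u = boolToℕ (f (up ∷ v))

count-allFlat : ∀ e (g : Vec Step e → Bool) →
  count (λ v → g v ∧ allFlat v) (allSeqs e) ≡ boolToℕ (g (V.replicate e flat))
count-allFlat zero g rewrite ∧-identityʳ (g []) = +-identityʳ _
count-allFlat (suc e) g = begin
  count (λ v → g v ∧ allFlat v) (allSeqs (suc e))
    ≡⟨ count-allSeqs-suc e _ ⟩
  count (λ v → g (down ∷ v) ∧ false) (allSeqs e) + count (λ v → g (flat ∷ v) ∧ allFlat v) (allSeqs e)
    + count (λ v → g (up ∷ v) ∧ false) (allSeqs e)
    ≡⟨ cong₂ (λ a b → a + count (λ v → g (flat ∷ v) ∧ allFlat v) (allSeqs e) + b)
             (count-false (allSeqs e) (λ v → ∧-zeroʳ (g (down ∷ v))))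
             (count-false (allSeqs e) (λ v → ∧-zeroʳ (g (up ∷ v)))) ⟩
  count (λ v → g (flat ∷ v) ∧ allFlat v) (allSeqs e) + 0
    ≡⟨ +-identityʳ _ ⟩
  count (λ v → g (flat ∷ v) ∧ allFlat v) (allSeqs e)
    ≡⟨ count-allFlat e (g ∘′ (flat ∷_)) ⟩
  boolToℕ (g (flat ∷ V.replicate e flat)) ∎
  where open ≡-Reasoning

-- A word of length n + e that is flat from position n on is a word of length n padded by flat steps.
count-flatFrom : ∀ n e (g : Vec Step (n + e) → Bool) →
  count (λ v → g v ∧ flatFromᵇ n v) (allSeqs (n + e)) ≡ count (λ u → g (u V.++ V.replicate e flat)) (allSeqs n)
count-flatFrom zero e g = trans (count-allFlat e g) (sym (+-identityʳ _))
count-flatFrom (suc n) e g = begin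
  count (λ v → g v ∧ flatFromᵇ (suc n) v) (allSeqs (suc n + e))
    ≡⟨ count-allSeqs-suc (n + e) _ ⟩
  count (λ v → g (down ∷ v) ∧ flatFromᵇ n v) (allSeqs (n + e))
    + count (λ v → g (flat ∷ v) ∧ flatFromᵇ n v) (allSeqs (n + e))
    + count (λ v → g (up ∷ v) ∧ flatFromᵇ n v) (allSeqs (n + e))
    ≡⟨ cong₂ _+_ (cong₂ _+_ (count-flatFrom n e (g ∘′ (down ∷_))) (count-flatFrom n e (g ∘′ (flat ∷_))))
                 (count-flatFrom n e (g ∘′ (up ∷_))) ⟩
  count (λ u → g (down ∷ u V.++ V.replicate e flat)) (allSeqs n)
    + count (λ u → g (flat ∷ u V.++ V.replicate e flat)) (allSeqs n)
    + count (λ u → g (up ∷ u V.++ V.replicate e flat)) (allSeqs n)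
    ≡⟨ count-allSeqs-suc n _ ⟨
  count (λ u → g (u V.++ V.replicate e flat)) (allSeqs (suc n)) ∎
  where open ≡-Reasoning

m-count : ∀ l r → m l r ≡ count (isPathOfRank r) (allSeqs l)
m-count l r = length-filter-count (isPathOfRank r) (allSeqs l)

count-paths-flatFrom : ∀ k l r → l ≤ k → count (λ p → isPathOfRank r p ∧ flatFromᵇ l p) (allSeqs k) ≡ m l r
count-paths-flatFrom k l r l≤k with e , refl ← m≤n⇒∃[o]m+o≡n l≤k = begin
  count (λ p → isPathOfRank r p ∧ flatFromᵇ l p) (allSeqs (l + e))
    ≡⟨ count-flatFrom l e (isPathOfRank r) ⟩
  count (λ u → isPathOfRank r (u V.++ V.replicate e flat)) (allSeqs l)
    ≡⟨ count-cong (allSeqs l) (isPathOfRank-++-flats r e) ⟩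
  count (isPathOfRank r) (allSeqs l)
    ≡⟨ m-count l r ⟨
  m l r ∎
  where open ≡-Reasoning

m-short : ∀ l r → l < r → m l r ≡ 0
m-short l r l<r = trans (m-count l r) (count-false (allSeqs l) (λ u → isPathOfRank-short r u l<r))

module _ {c ℓ : Level} (R : CommutativeRing c ℓ) where
  open CommutativeRing R using (Carrier; 0#; 1#; _≈_; +-cong; +-identityˡ; reflexive)
    renaming (_+_ to _+ᴿ_; refl to ≈-refl; trans to ≈-trans)

  indicator : Bool → Carrier
  indicator b = if b then 1# else 0#

  coeff-one : ∀ x r l {k} (p : Vec Step k) → heightWalk 0 (toList p) ≡ just r →
    coeff R x r (one l k) p p ≡ indicator (flatFromᵇ l p)
  coeff-one x r l {k} p hw with flatFromᵇ l p in e
  ... | true rewrite rankAct-one l r p hw (flatFromᵇ-sound l p e) | actPath-one-fixes l r p hw (flatFromᵇ-sound l p e)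
                   | κ-one l p | trans (isYes≗does (r N.≟ r)) (dec-true (r N.≟ r) refl) | eqVec-refl p = refl
  ... | false with eqVec (actPath (one l k) p) p in fixes
  ...   | true with () ← trans (sym e) (flatFromᵇ-complete l p (actPath-one-fixes⇒flatFrom l p (eqVec-sound _ p fixes)))
  ...   | false rewrite ∧-zeroʳ ⌊ rankAct (one l k) p N.≟ r ⌋ = refl

  sum-indicator : {A : Set} (g b : A → Bool) (h : A → Carrier) (xs : List A) →
    (∀ x → g x ≡ true → h x ≡ indicator (b x)) →
    foldr _+ᴿ_ 0# (map h (filter (λ x → g x B.≟ true) xs)) ≈ natR R (count (λ x → g x ∧ b x) xs)
  sum-indicator g b h [] _ = ≈-refl
  sum-indicator g b h (x ∷ xs) hx with g x in gx
  ... | false = sum-indicator g b h xs hx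
  ... | true with b x in bx
  ...   | true = +-cong (reflexive (trans (hx x gx) (cong indicator bx))) (sum-indicator g b h xs hx)
  ...   | false = ≈-trans (+-cong (reflexive (trans (hx x gx) (cong indicator bx))) (sum-indicator g b h xs hx))
                          (+-identityˡ _)

  χ-one : ∀ x k r l → l ≤ k → χ R x k r (one l k) ≈ natR R (m l r)
  χ-one x k r l l≤k =
    ≈-trans (sum-indicator (isPathOfRank r) (flatFromᵇ l) (λ p → coeff R x r (one l k) p p) (allSeqs k)
               (λ p e → coeff-one x r l p (isPathOfRank-sound r p e)))
            (reflexive (cong (natR R) (count-paths-flatFrom k l r l≤k)))

mainTheorem9 : ∀ {c ℓ : Level} (R : CommutativeRing c ℓ) (x : CommutativeRing.Carrier R)
    (k r l : ℕ) → r ≤ k → l ≤ k →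
    (r ≤ l → CommutativeRing._≈_ R (χ R x k r (one l k)) (natR R (m l r)))
    × (l < r → CommutativeRing._≈_ R (χ R x k r (one l k)) (CommutativeRing.0# R))
mainTheorem9 R x k r l _ l≤k =
  (λ _ → χ-one R x k r l l≤k) ,
  (λ l<r → ≈-trans (χ-one R x k r l l≤k) (reflexive (cong (natR R) (m-short l r l<r))))
  where open CommutativeRing R using (reflexive) renaming (trans to ≈-trans)
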